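{- Let $F$ be a forest such that its edge ideal $\overline F$ is spherical. Then $\gamma(F)=i(F)$.
   Context: $\gamma(F)$ is the domination number (minimum size of a dominating set) and $i(F)$ the independent domination number (minimum size of an independent dominating set). For $F$ on vertex set $X=\{x_1,\dots,x_n\}$, $\overline F\subset\mathbb{Z}[X]$ is generated by $x_1^2,\ldots,x_n^2$ and $x_ix_j$ for edges $\{x_i,x_j\}$. For a monomial ideal $I$ containing all $x_i^2$: $R(I)$ is the simplicial complex of monomials not in $I$; $(I:x)=\{m:xm\in I\}$; $R(I)$ is a cone with apex $a$ if $(I:a)=(I,a)$; $a$ dominates $b$ in $I$ if $R(I)$ is not a cone with apex $b$ but $R((I,a))$ is. A sequence $(a_1,\ldots,a_r)$ of variables with $I_i=(I:a_1\cdots a_{i-1})$ is a resolution if for all $i\in[r]$, $a_i\notin I_i$ and either $R(I_i)$ is a cone with apex $a_i$ or $a_i$ dominates some variable in $I_i$; it is maximal if not extendable, and spherical if no $R(I_i)$ ($i\in[r]$) is a cone with apex $a_i$. $I$ is spherical if it admits a spherical maximal resolution. -}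

module Defs where

open import Data.Nat using (ℕ; zero; suc; _+_; _≤_)
open import Data.Fin using (Fin; toℕ)
open import Data.Fin.Subset using (Subset; _∈_; ∣_∣)
open import Data.List using (List; []; _∷_; _++_; [_]; length; lookup; take; _∷ʳ_)
open import Data.List.Relation.Unary.Linked using (Linked)
open import Data.List.Relation.Unary.Unique.Propositional using (Unique)
open import Data.Product using (Σ; ∃; ∃-syntax; _×_; _,_)
open import Data.Sum using (_⊎_)
open import Relation.Binary.PropositionalEquality using (_≡_; _≢_)
open import Relation.Nullary using (¬_)

record SimpleGraph (n : ℕ) : Set₁ where
  field
    Adj   : Fin n → Fin n → Set
    sym   : ∀ {u v} → Adj u v → Adj v u
    irrefl : ∀ {u} → ¬ Adj u u
open SimpleGraph public

HasCycle : ∀ {n} → SimpleGraph n → Set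
HasCycle {n} G =
  Σ (Fin n) λ v₀ → Σ (List (Fin n)) λ vs →
    (2 ≤ length vs) × Unique (v₀ ∷ vs) × Linked (Adj G) ((v₀ ∷ vs) ∷ʳ v₀)

IsForest : ∀ {n} → SimpleGraph n → Set
IsForest G = ¬ HasCycle G

IsDominating : ∀ {n} → SimpleGraph n → Subset n → Set
IsDominating {n} G S = ∀ (v : Fin n) → v ∈ S ⊎ (∃[ u ] (u ∈ S × Adj G u v))

IsIndependent : ∀ {n} → SimpleGraph n → Subset n → Set
IsIndependent G S = ∀ u v → u ∈ S → v ∈ S → ¬ Adj G u v

IsDominationNumber : ∀ {n} → SimpleGraph n → ℕ → Set
IsDominationNumber G k =
  (∃[ S ] (IsDominating G S × ∣ S ∣ ≡ k)) ×
  (∀ S → IsDominating G S → k ≤ ∣ S ∣)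

IsIndepDominationNumber : ∀ {n} → SimpleGraph n → ℕ → Set
IsIndepDominationNumber G k =
  (∃[ S ] (IsDominating G S × IsIndependent G S × ∣ S ∣ ≡ k)) ×
  (∀ S → IsDominating G S → IsIndependent G S → k ≤ ∣ S ∣)

-- Monomials in ℤ[x₁,…,xₙ] (monic, as exponent vectors) and monomial ideals,
-- represented by the set of monomials they contain.

Monomial : ℕ → Set
Monomial n = Fin n → ℕ

_∣ₘ_ : ∀ {n} → Monomial n → Monomial n → Set
g ∣ₘ m = ∀ i → g i ≤ m i

_*ₘ_ : ∀ {n} → Monomial n → Monomial n → Monomial n
(u *ₘ m) i = u i + m i

oneₘ : ∀ {n} → Monomial n
oneₘ _ = 0

var : ∀ {n} → Fin n → Monomial n
var {suc n} Fin.zero Fin.zero = 1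
var {suc n} Fin.zero (Fin.suc j) = 0
var {suc n} (Fin.suc a) Fin.zero = 0
var {suc n} (Fin.suc a) (Fin.suc j) = var a j

prodVars : ∀ {n} → List (Fin n) → Monomial n
prodVars [] = oneₘ
prodVars (a ∷ as) = var a *ₘ prodVars as

MonIdeal : ℕ → Set₁
MonIdeal n = Monomial n → Set

generated : ∀ {n} → (Monomial n → Set) → MonIdeal n
generated Gen m = ∃[ g ] (Gen g × g ∣ₘ m)

data EdgeGen {n} (G : SimpleGraph n) : Monomial n → Set where
  square : ∀ i → EdgeGen G (var i *ₘ var i)
  edge   : ∀ i j → Adj G i j → EdgeGen G (var i *ₘ var j)

edgeIdeal : ∀ {n} → SimpleGraph n → MonIdeal n
edgeIdeal G = generated (EdgeGen G)

_∶_ : ∀ {n} → MonIdeal n → Monomial n → MonIdeal n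
(I ∶ u) m = I (u *ₘ m)

_,ᵥ_ : ∀ {n} → MonIdeal n → Fin n → MonIdeal n
(I ,ᵥ a) m = I m ⊎ (var a ∣ₘ m)

_≐_ : ∀ {n} → MonIdeal n → MonIdeal n → Set
I ≐ J = ∀ m → (I m → J m) × (J m → I m)

-- R(I) is a cone with apex a  :⇔  (I : a) = (I , a)
IsCone : ∀ {n} → MonIdeal n → Fin n → Set
IsCone I a = (I ∶ var a) ≐ (I ,ᵥ a)

Dominates : ∀ {n} → MonIdeal n → Fin n → Fin n → Set
Dominates I a b = ¬ IsCone I b × IsCone (I ,ᵥ a) b

-- I_i = (I : a₁⋯a_{i-1}), indices i counted from 0 here
stageIdeal : ∀ {n} → MonIdeal n → (as : List (Fin n)) → Fin (length as) → MonIdeal n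
stageIdeal I as i = I ∶ prodVars (take (toℕ i) as)

IsResolution : ∀ {n} → MonIdeal n → List (Fin n) → Set
IsResolution {n} I as = ∀ (i : Fin (length as)) →
  let Iᵢ = stageIdeal I as i ; aᵢ = lookup as i in
  ¬ Iᵢ (var aᵢ) × (IsCone Iᵢ aᵢ ⊎ ∃[ b ] Dominates Iᵢ aᵢ b)

IsMaximalResolution : ∀ {n} → MonIdeal n → List (Fin n) → Set
IsMaximalResolution {n} I as =
  IsResolution I as × (∀ (a : Fin n) → ¬ IsResolution I (as ∷ʳ a))

IsSphericalSeq : ∀ {n} → MonIdeal n → List (Fin n) → Set
IsSphericalSeq I as = ∀ (i : Fin (length as)) →
  ¬ IsCone (stageIdeal I as i) (lookup as i)

IsSpherical : ∀ {n} → MonIdeal n → Set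
IsSpherical I = ∃[ as ] (IsMaximalResolution I as × IsSphericalSeq I as)

{-# OPTIONS --safe #-}
module Submission where

-- Let (a₁,…,a_r) be a spherical maximal resolution of F̄ and W_k the closed neighbourhood of
-- {a₁,…,a_{k-1}}. As long as this set is independent, (F̄ : a₁⋯a_{k-1}) = F̄ + (x_w : w ∈ W_k),
-- whose cone points are the isolated vertices of F − W_k. So every step, being no cone step,
-- picks a_k ∉ W_k adjacent to some b_k whose only neighbour outside W_k is a_k; in particular the
-- a_k are independent. By maximality they dominate F, since a vertex of degree at most one in the
-- forest F − W_{r+1} would extend the resolution; hence i(F) ≤ r. Conversely, against any dominating
-- set D, each step either exhausts a D-vertex of N[a_k] ∪ N[b_k] or joins, through the path
-- b_k a_k, two groups of D-vertices that were not yet connected inside W_k, as F has no cycles.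
-- Hence r ≤ |D|, and r ≤ γ(F) ≤ i(F) ≤ r.

open import Defs
open import Data.Empty using (⊥; ⊥-elim)
open import Data.Fin using (Fin; zero; suc; toℕ)
open import Data.Fin.Properties using (_≟_; any?; injective⇒≤)
open import Data.Fin.Subset using (Subset; ∣_∣; _-_; ⁅_⁆; _∪_; inside; outside)
  renaming (_∈_ to _∈ₛ_; ⊥ to ∅)
open import Data.Fin.Subset.Properties
  using (x∈p∧x≢y⇒x∈p-y; x∈p⇒∣p-x∣<∣p∣; x∈p∪q⁺; x∈p∪q⁻; x∈⁅x⁆; x∈⁅y⁆⇒x≡y; ∉⊥; ∣⊥∣≡0; ∣⁅x⁆∣≡1; ∣p∣≤∣x∷p∣)
  renaming (_∈?_ to _∈ₛ?_)
open import Data.List using (List; []; _∷_; _++_; [_]; length; lookup; take; _∷ʳ_)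
open import Data.List.Properties using (++-identityʳ; ++-assoc)
open import Data.List.Membership.Propositional using (_∈_; _∉_)
open import Data.List.Membership.Propositional.Properties using (∈-++⁺ˡ; ∈-++⁺ʳ; ∈-++⁻; ∈-lookup)
open import Data.List.Relation.Unary.Any as Any using (here; there)
open import Data.List.Relation.Unary.All as All using (All; []; _∷_)
open import Data.List.Relation.Unary.All.Properties using (¬Any⇒All¬)
open import Data.List.Relation.Unary.AllPairs using ([]; _∷_)
open import Data.List.Relation.Unary.Linked using (Linked; [-]; _∷_)
open import Data.List.Relation.Unary.Unique.Propositional using (Unique)
open import Data.List.Relation.Unary.Unique.Propositional.Properties using (take⁺)
open import Data.Nat as ℕ using (ℕ; zero; suc; _+_; _≤_; _<_; z≤n; s≤s)
open import Data.Nat.Properties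
  using (≤-refl; ≤-trans; ≤-reflexive; ≤-antisym; m≤m+n; m≤n+m; +-mono-≤; +-monoʳ-≤; +-identityʳ;
         +-assoc; +-suc; n<1⇒n≡0; ≰⇒>; <⇒≱; 1+n≰n; module ≤-Reasoning)
open import Data.Product using (∃₂; ∃-syntax; _×_; _,_; proj₁; proj₂; uncurry)
open import Data.Sum as Sum using (_⊎_; inj₁; inj₂; [_,_]′)
open import Data.Unit using (⊤; tt)
open import Data.Vec using ([]; _∷_)
open import Function using (_∘_; id)
open import Function.Bundles using (_⇔_; mk⇔; Equivalence)
open import Function.Definitions using (Injective)
open import Relation.Binary.Construct.Closure.ReflexiveTransitive as Star using (Star; ε; _◅_; _◅◅_)
open import Relation.Binary.PropositionalEquality using (_≡_; _≢_; refl; trans; cong; cong₂; subst)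
  renaming (sym to ≡-sym)
open import Relation.Nullary using (¬_; Dec; yes; no; ¬?)
open import Relation.Nullary.Decidable using (decidable-stable; _×-dec_; _⊎-dec_; ¬¬-excluded-middle)

open Equivalence using (to; from)

private
  variable
    n : ℕ
    a b u v w x y z : Fin n
    L pre rest vs : List (Fin n)
    m m′ : Monomial n
    W W′ : Fin n → Set
    I J K : MonIdeal n

1≤m+n⇒1≤m⊎1≤n : ∀ {m n : ℕ} → 1 ≤ m + n → 1 ≤ m ⊎ 1 ≤ n
1≤m+n⇒1≤m⊎1≤n {zero}  h = inj₂ h
1≤m+n⇒1≤m⊎1≤n {suc m} _ = inj₁ (s≤s z≤n)

2≤m+n⇒1≤m×1≤n⊎2≤n : ∀ {m n : ℕ} → m ≤ 1 → 2 ≤ m + n → (1 ≤ m × 1 ≤ n) ⊎ 2 ≤ n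
2≤m+n⇒1≤m×1≤n⊎2≤n {zero}        _        h       = inj₂ h
2≤m+n⇒1≤m×1≤n⊎2≤n {suc zero}    _        (s≤s h) = inj₁ (s≤s z≤n , h)
2≤m+n⇒1≤m×1≤n⊎2≤n {suc (suc m)} (s≤s ()) _

∣p∪q∣≤∣p∣+∣q∣ : (p q : Subset n) → ∣ p ∪ q ∣ ≤ ∣ p ∣ + ∣ q ∣
∣p∪q∣≤∣p∣+∣q∣ []            []            = z≤n
∣p∪q∣≤∣p∣+∣q∣ (inside ∷ p)  (s ∷ q)       =
  s≤s (≤-trans (∣p∪q∣≤∣p∣+∣q∣ p q) (+-monoʳ-≤ ∣ p ∣ (∣p∣≤∣x∷p∣ s q)))
∣p∪q∣≤∣p∣+∣q∣ (outside ∷ p) (inside ∷ q)  =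
  subst (suc ∣ p ∪ q ∣ ≤_) (≡-sym (+-suc ∣ p ∣ ∣ q ∣)) (s≤s (∣p∪q∣≤∣p∣+∣q∣ p q))
∣p∪q∣≤∣p∣+∣q∣ (outside ∷ p) (outside ∷ q) = ∣p∪q∣≤∣p∣+∣q∣ p q

¬¬-∀-Fin : {P : Fin n → Set} → (∀ x → ¬ ¬ P x) → ¬ ¬ (∀ x → P x)
¬¬-∀-Fin {zero}  _  ¬∀ = ¬∀ λ ()
¬¬-∀-Fin {suc n} ¬¬P ¬∀ =
  ¬¬P zero λ P₀ → ¬¬-∀-Fin (¬¬P ∘ suc) λ Pₛ → ¬∀ λ { zero → P₀ ; (suc x) → Pₛ x }

_∈?_ : (x : Fin n) (L : List (Fin n)) → Dec (x ∈ L)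
x ∈? L = Any.any? (x ≟_) L

lookup-injective : {xs : List (Fin n)} → Unique xs → Injective _≡_ _≡_ (lookup xs)
lookup-injective             (_  ∷ _) {zero}  {zero}  _  = refl
lookup-injective             (x∉ ∷ _) {zero}  {suc j} eq = ⊥-elim (All.lookup x∉ (∈-lookup j) eq)
lookup-injective             (x∉ ∷ _) {suc i} {zero}  eq = ⊥-elim (All.lookup x∉ (∈-lookup i) (≡-sym eq))
lookup-injective {xs = _ ∷ _} (_ ∷ u) {suc i} {suc j} eq = cong suc (lookup-injective u eq)

Unique⇒length≤ : {xs : List (Fin n)} → Unique xs → length xs ≤ n
Unique⇒length≤ u = injective⇒≤ (lookup-injective u)

fromList : List (Fin n) → Subset n
fromList []      = ∅
fromList (a ∷ L) = ⁅ a ⁆ ∪ fromList L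

∈-fromList⁺ : a ∈ L → a ∈ₛ fromList L
∈-fromList⁺ {L = b ∷ L} (here refl) = x∈p∪q⁺ (inj₁ (x∈⁅x⁆ b))
∈-fromList⁺             (there a∈)  = x∈p∪q⁺ (inj₂ (∈-fromList⁺ a∈))

∈-fromList⁻ : (L : List (Fin n)) → a ∈ₛ fromList L → a ∈ L
∈-fromList⁻ []      a∈ = ⊥-elim (∉⊥ a∈)
∈-fromList⁻ (b ∷ L) a∈ = [ here ∘ x∈⁅y⁆⇒x≡y b , there ∘ ∈-fromList⁻ L ]′ (x∈p∪q⁻ ⁅ b ⁆ (fromList L) a∈)

∣fromList∣≤length : (L : List (Fin n)) → ∣ fromList L ∣ ≤ length L
∣fromList∣≤length {n} [] = ≤-reflexive (∣⊥∣≡0 n)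
∣fromList∣≤length (a ∷ L) =
  ≤-trans (∣p∪q∣≤∣p∣+∣q∣ ⁅ a ⁆ (fromList L)) (+-mono-≤ (≤-reflexive (∣⁅x⁆∣≡1 a)) (∣fromList∣≤length L))

-- Monomials

var-diag : (i : Fin n) → var i i ≡ 1
var-diag {suc n} zero    = refl
var-diag {suc n} (suc i) = var-diag i

var-offdiag : {i j : Fin n} → i ≢ j → var i j ≡ 0
var-offdiag {suc n} {zero}  {zero}  i≢j = ⊥-elim (i≢j refl)
var-offdiag {suc n} {zero}  {suc j} _   = refl
var-offdiag {suc n} {suc i} {zero}  _   = refl
var-offdiag {suc n} {suc i} {suc j} i≢j = var-offdiag (i≢j ∘ cong suc)

var≤1 : (i j : Fin n) → var i j ≤ 1
var≤1 {suc n} zero    zero    = ≤-refl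
var≤1 {suc n} zero    (suc j) = z≤n
var≤1 {suc n} (suc i) zero    = z≤n
var≤1 {suc n} (suc i) (suc j) = var≤1 i j

var-support : {i j : Fin n} → 1 ≤ var i j → i ≡ j
var-support {suc n} {zero}  {zero}  _ = refl
var-support {suc n} {suc i} {suc j} h = cong suc (var-support h)

var∣ₘ⁺ : 1 ≤ m a → var a ∣ₘ m
var∣ₘ⁺ {a = a} h k with a ≟ k
... | yes refl = ≤-trans (≤-reflexive (var-diag a)) h
... | no a≢k   = ≤-trans (≤-reflexive (var-offdiag a≢k)) z≤n

var∣ₘ⁻ : var a ∣ₘ m → 1 ≤ m a
var∣ₘ⁻ {a = a} d = ≤-trans (≤-reflexive (≡-sym (var-diag a))) (d a)

var²∣ₘ⁺ : 2 ≤ m a → (var a *ₘ var a) ∣ₘ m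
var²∣ₘ⁺ {a = a} h k with a ≟ k
... | yes refl = ≤-trans (≤-reflexive (cong (λ e → e + e) (var-diag a))) h
... | no a≢k   = ≤-trans (≤-reflexive (cong (λ e → e + e) (var-offdiag a≢k))) z≤n

var²∣ₘ⁻ : (var a *ₘ var a) ∣ₘ m → 2 ≤ m a
var²∣ₘ⁻ {a = a} d = ≤-trans (≤-reflexive (cong (λ e → e + e) (≡-sym (var-diag a)))) (d a)

var*var∣ₘ⁺ : a ≢ b → 1 ≤ m a → 1 ≤ m b → (var a *ₘ var b) ∣ₘ m
var*var∣ₘ⁺ {a = a} {b = b} a≢b ha hb k with a ≟ k | b ≟ k
... | yes refl | yes refl = ⊥-elim (a≢b refl)
... | yes refl | no b≢k   = ≤-trans (≤-reflexive (cong₂ _+_ (var-diag a) (var-offdiag b≢k))) ha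
... | no a≢k   | yes refl = ≤-trans (≤-reflexive (cong₂ _+_ (var-offdiag a≢k) (var-diag b))) hb
... | no a≢k   | no b≢k   = ≤-trans (≤-reflexive (cong₂ _+_ (var-offdiag a≢k) (var-offdiag b≢k))) z≤n

var*var∣ₘ⁻ : (var a *ₘ var b) ∣ₘ m → 1 ≤ m a × 1 ≤ m b
var*var∣ₘ⁻ d = var∣ₘ⁻ (λ k → ≤-trans (m≤m+n _ _) (d k)) , var∣ₘ⁻ (λ k → ≤-trans (m≤n+m _ _) (d k))

m∣ₘp*ₘm : (p m : Monomial n) → m ∣ₘ (p *ₘ m)
m∣ₘp*ₘm p m k = m≤n+m (m k) (p k)

SquareFree : Monomial n → Set
SquareFree m = ∀ k → m k ≤ 1

prodVars-∈ : a ∈ L → 1 ≤ prodVars L a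
prodVars-∈ {a = a} (here refl) = ≤-trans (≤-reflexive (≡-sym (var-diag a))) (m≤m+n _ _)
prodVars-∈         (there a∈)  = ≤-trans (prodVars-∈ a∈) (m≤n+m _ _)

prodVars-support : (L : List (Fin n)) → 1 ≤ prodVars L a → a ∈ L
prodVars-support (b ∷ L) h =
  [ here ∘ ≡-sym ∘ var-support , there ∘ prodVars-support L ]′ (1≤m+n⇒1≤m⊎1≤n h)

∉⇒prodVars≡0 : (L : List (Fin n)) → a ∉ L → prodVars L a ≡ 0
∉⇒prodVars≡0 L a∉ = n<1⇒n≡0 (≰⇒> (a∉ ∘ prodVars-support L))

prodVars-∷ʳ : (L : List (Fin n)) (a k : Fin n) → prodVars (L ∷ʳ a) k ≡ prodVars L k + var a k
prodVars-∷ʳ []      a k = +-identityʳ (var a k)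
prodVars-∷ʳ (b ∷ L) a k = trans (cong (var b k +_) (prodVars-∷ʳ L a k)) (≡-sym (+-assoc (var b k) _ _))

-- Monomial ideals and resolutions

≐-sym : I ≐ J → J ≐ I
≐-sym I≐J m = proj₂ (I≐J m) , proj₁ (I≐J m)

≐-trans : I ≐ J → J ≐ K → I ≐ K
≐-trans I≐J J≐K m = proj₁ (J≐K m) ∘ proj₁ (I≐J m) , proj₂ (I≐J m) ∘ proj₂ (J≐K m)

,ᵥ-resp-≐ : I ≐ J → (I ,ᵥ a) ≐ (J ,ᵥ a)
,ᵥ-resp-≐ I≐J m = Sum.map₁ (proj₁ (I≐J m)) , Sum.map₁ (proj₂ (I≐J m))

IsCone-resp-≐ : I ≐ J → IsCone I a → IsCone J a
IsCone-resp-≐ {a = a} I≐J cone m =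
  proj₁ (,ᵥ-resp-≐ I≐J m) ∘ proj₁ (cone m) ∘ proj₂ (I≐J (var a *ₘ m)) ,
  proj₁ (I≐J (var a *ₘ m)) ∘ proj₂ (cone m) ∘ proj₂ (,ᵥ-resp-≐ I≐J m)

ResolutionStep : MonIdeal n → Fin n → Set
ResolutionStep I a = ¬ I (var a) × (IsCone I a ⊎ ∃[ b ] Dominates I a b)

SphericalStep : MonIdeal n → Fin n → Set
SphericalStep I a = ResolutionStep I a × ¬ IsCone I a

module _ {A : Set} where

  -- IsResolution I and IsSphericalSeq I unfold to instances of AllWithPrefix.
  AllWithPrefix : (List A → A → Set) → List A → Set
  AllWithPrefix P as = ∀ (i : Fin (length as)) → P (take (toℕ i) as) (lookup as i)

  AllWithPrefix-∷ʳ : ∀ {P as a} → AllWithPrefix P as → P as a → AllWithPrefix P (as ∷ʳ a)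
  AllWithPrefix-∷ʳ         {as = []}    _ Pa zero    = Pa
  AllWithPrefix-∷ʳ         {as = _ ∷ _} h _  zero    = h zero
  AllWithPrefix-∷ʳ {P = P} {as = c ∷ _} h Pa (suc i) =
    AllWithPrefix-∷ʳ {P = P ∘ (c ∷_)} (h ∘ suc) Pa i

  Chain : (List A → A → Set) → List A → List A → Set
  Chain P pre []         = ⊤
  Chain P pre (a ∷ rest) = P pre a × Chain P (pre ∷ʳ a) rest

  AllWithPrefix⇒Chain : ∀ {P} (pre rest : List A) → AllWithPrefix (P ∘ (pre ++_)) rest → Chain P pre rest
  AllWithPrefix⇒Chain         pre []         _ = tt
  AllWithPrefix⇒Chain {P = P} pre (a ∷ rest) h =
    subst (λ p → P p a) (++-identityʳ pre) (h zero) ,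
    AllWithPrefix⇒Chain (pre ∷ʳ a) rest λ i →
      subst (λ p → P p (lookup rest i)) (≡-sym (++-assoc pre [ a ] (take (toℕ i) rest))) (h (suc i))

module _ (F : SimpleGraph n) where

  Adj⇒≢ : Adj F a b → a ≢ b
  Adj⇒≢ ab refl = irrefl F ab

  ClosedAdj : Fin n → Fin n → Set
  ClosedAdj u v = u ≡ v ⊎ Adj F u v

  N[_] : List (Fin n) → Fin n → Set
  N[ L ] v = ∃[ u ] (u ∈ L × ClosedAdj u v)

  N-∷ʳ⁺ˡ : N[ L ] v → N[ L ∷ʳ a ] v
  N-∷ʳ⁺ˡ (u , u∈ , uv) = u , ∈-++⁺ˡ u∈ , uv

  N-∷ʳ⁺ʳ : ClosedAdj a v → N[ L ∷ʳ a ] v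
  N-∷ʳ⁺ʳ {L = L} av = _ , ∈-++⁺ʳ L (here refl) , av

  _∪⁅_⁆ : (Fin n → Set) → Fin n → Fin n → Set
  (W ∪⁅ a ⁆) x = W x ⊎ a ≡ x

  IndependentList : List (Fin n) → Set
  IndependentList L = SquareFree (prodVars L) × (∀ {u v} → u ∈ L → v ∈ L → ¬ Adj F u v)

  IndependentList-∷ʳ : IndependentList L → ¬ N[ L ] a → IndependentList (L ∷ʳ a)
  IndependentList-∷ʳ {L = L} {a = a} (squareFree , indep) a∉ = squareFree′ , indep′
    where
    a∉L : a ∉ L
    a∉L a∈ = a∉ (a , a∈ , inj₁ refl)
    squareFree′ : SquareFree (prodVars (L ∷ʳ a))
    squareFree′ k rewrite prodVars-∷ʳ L a k with a ≟ k
    ... | yes refl rewrite ∉⇒prodVars≡0 L a∉L | var-diag a = ≤-refl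
    ... | no a≢k   rewrite var-offdiag a≢k | +-identityʳ (prodVars L k) = squareFree k
    ∈-∷ʳ⁻ : u ∈ L ∷ʳ a → u ∈ L ⊎ u ≡ a
    ∈-∷ʳ⁻ u∈ = Sum.map₂ (λ { (here u≡a) → u≡a }) (∈-++⁻ L u∈)
    indep′ : u ∈ L ∷ʳ a → v ∈ L ∷ʳ a → ¬ Adj F u v
    indep′ u∈ v∈ with ∈-∷ʳ⁻ u∈ | ∈-∷ʳ⁻ v∈
    ... | inj₁ u∈L  | inj₁ v∈L  = indep u∈L v∈L
    ... | inj₁ u∈L  | inj₂ refl = λ ua → a∉ (_ , u∈L , inj₂ ua)
    ... | inj₂ refl | inj₁ v∈L  = λ av → a∉ (_ , v∈L , inj₂ (sym F av))
    ... | inj₂ refl | inj₂ refl = irrefl F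

  -- The ideal F̄ + (x_w : w ∈ W), whose complex R is the independence complex of F − W.
  data EdgeIdeal+ (W : Fin n → Set) : MonIdeal n where
    has-square : (i : Fin n) → 2 ≤ m i → EdgeIdeal+ W m
    has-edge   : Adj F u v → 1 ≤ m u → 1 ≤ m v → EdgeIdeal+ W m
    meets      : W u → 1 ≤ m u → EdgeIdeal+ W m

  EdgeIdeal+-mono : (∀ {x} → W x → W′ x) → m ∣ₘ m′ → EdgeIdeal+ W m → EdgeIdeal+ W′ m′
  EdgeIdeal+-mono _ d (has-square i h)    = has-square i (≤-trans h (d i))
  EdgeIdeal+-mono _ d (has-edge uv hu hv) = has-edge uv (≤-trans hu (d _)) (≤-trans hv (d _))
  EdgeIdeal+-mono f d (meets Wu hu)       = meets (f Wu) (≤-trans hu (d _))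

  var∈EdgeIdeal+ : EdgeIdeal+ W (var x) ⇔ W x
  var∈EdgeIdeal+ {W = W} {x = x} = mk⇔ to′ (λ Wx → meets Wx (≤-reflexive (≡-sym (var-diag x))))
    where
    to′ : EdgeIdeal+ W (var x) → W x
    to′ (has-square i h)    = ⊥-elim (<⇒≱ h (var≤1 x i))
    to′ (has-edge uv hu hv) = ⊥-elim (Adj⇒≢ uv (trans (≡-sym (var-support hu)) (var-support hv)))
    to′ (meets Wu hu)       = subst W (≡-sym (var-support hu)) Wu

  oneₘ∉EdgeIdeal+ : ¬ EdgeIdeal+ W oneₘ
  oneₘ∉EdgeIdeal+ (has-square _ ())
  oneₘ∉EdgeIdeal+ (has-edge _ () _)
  oneₘ∉EdgeIdeal+ (meets _ ())

  EdgeIdeal+-,ᵥ : (EdgeIdeal+ W ,ᵥ a) ≐ EdgeIdeal+ (W ∪⁅ a ⁆)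
  EdgeIdeal+-,ᵥ m = [ EdgeIdeal+-mono inj₁ (λ _ → ≤-refl) , meets (inj₂ refl) ∘ var∣ₘ⁻ ]′ , from′
    where
    from′ : EdgeIdeal+ (W ∪⁅ a ⁆) m → (EdgeIdeal+ W ,ᵥ a) m
    from′ (has-square i h)       = inj₁ (has-square i h)
    from′ (has-edge uv hu hv)    = inj₁ (has-edge uv hu hv)
    from′ (meets (inj₁ Wu) hu)   = inj₁ (meets Wu hu)
    from′ (meets (inj₂ refl) hu) = inj₂ (var∣ₘ⁺ hu)

  IsolatedOutside : (Fin n → Set) → Fin n → Set
  IsolatedOutside W u = ¬ W u × (∀ x → Adj F u x → W x)

  isolated⇒cone : IsolatedOutside W u → IsCone (EdgeIdeal+ W) u
  isolated⇒cone {W = W} {u = u} (u∉ , nbrs) m = to′ , from′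
    where
    at : ∀ {i} → 1 ≤ var u i + m i → u ≡ i ⊎ 1 ≤ m i
    at = Sum.map₁ var-support ∘ 1≤m+n⇒1≤m⊎1≤n
    to′ : EdgeIdeal+ W (var u *ₘ m) → (EdgeIdeal+ W ,ᵥ u) m
    to′ (has-square i h) with 2≤m+n⇒1≤m×1≤n⊎2≤n (var≤1 u i) h
    ... | inj₁ (hu , hi) = inj₂ (var∣ₘ⁺ (subst (λ k → 1 ≤ m k) (≡-sym (var-support hu)) hi))
    ... | inj₂ hi        = inj₁ (has-square i hi)
    to′ (has-edge ij hi hj) with at hi | at hj
    ... | inj₁ refl | inj₁ refl = ⊥-elim (irrefl F ij)
    ... | inj₁ refl | inj₂ hj′  = inj₁ (meets (nbrs _ ij) hj′)
    ... | inj₂ hi′  | inj₁ refl = inj₁ (meets (nbrs _ (sym F ij)) hi′)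
    ... | inj₂ hi′  | inj₂ hj′  = inj₁ (has-edge ij hi′ hj′)
    to′ (meets Wi hi) with at hi
    ... | inj₁ refl = ⊥-elim (u∉ Wi)
    ... | inj₂ hi′  = inj₁ (meets Wi hi′)
    from′ : (EdgeIdeal+ W ,ᵥ u) m → EdgeIdeal+ W (var u *ₘ m)
    from′ (inj₁ h) = EdgeIdeal+-mono id (m∣ₘp*ₘm (var u) m) h
    from′ (inj₂ d) = has-square u (+-mono-≤ (≤-reflexive (≡-sym (var-diag u))) (var∣ₘ⁻ d))

  cone⇒isolated : IsCone (EdgeIdeal+ W) u → IsolatedOutside W u
  cone⇒isolated {W = W} {u = u} cone = u∉ , nbrs
    where
    u∉ : ¬ W u
    u∉ Wu = [ oneₘ∉EdgeIdeal+ , 1+n≰n ∘ var∣ₘ⁻ ]′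
              (proj₁ (cone oneₘ) (meets Wu (≤-trans (≤-reflexive (≡-sym (var-diag u))) (m≤m+n _ _))))
    nbrs : ∀ x → Adj F u x → W x
    nbrs x ux = [ to var∈EdgeIdeal+ , (λ d → ⊥-elim (Adj⇒≢ ux (≡-sym (var-support (var∣ₘ⁻ d))))) ]′
                  (proj₁ (cone (var x)) (uncurry (has-edge ux) (var*var∣ₘ⁻ {a = u} {b = x} (λ _ → ≤-refl))))

  cone⇔isolated : I ≐ EdgeIdeal+ W → IsCone I u ⇔ IsolatedOutside W u
  cone⇔isolated I≐ = mk⇔ (cone⇒isolated ∘ IsCone-resp-≐ I≐) (IsCone-resp-≐ (≐-sym I≐) ∘ isolated⇒cone)

  var∈⇔ : I ≐ EdgeIdeal+ W → I (var x) ⇔ W x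
  var∈⇔ {x = x} I≐ = mk⇔ (to var∈EdgeIdeal+ ∘ proj₁ (I≐ (var x))) (proj₂ (I≐ (var x)) ∘ from var∈EdgeIdeal+)

  stage : List (Fin n) → MonIdeal n
  stage L = edgeIdeal F ∶ prodVars L

  stage≐ : IndependentList L → stage L ≐ EdgeIdeal+ N[ L ]
  stage≐ {L = L} (squareFree , indep) m = to′ , from′
    where
    P : Monomial n
    P = prodVars L
    at : ∀ {i} → 1 ≤ P i + m i → i ∈ L ⊎ 1 ≤ m i
    at = Sum.map₁ (prodVars-support L) ∘ 1≤m+n⇒1≤m⊎1≤n
    to′ : stage L m → EdgeIdeal+ N[ L ] m
    to′ (_ , square i , d) with 2≤m+n⇒1≤m×1≤n⊎2≤n (squareFree i) (var²∣ₘ⁻ d)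
    ... | inj₁ (hP , hi) = meets (i , prodVars-support L hP , inj₁ refl) hi
    ... | inj₂ hi        = has-square i hi
    to′ (_ , edge i j ij , d) with at (proj₁ (var*var∣ₘ⁻ d)) | at (proj₂ (var*var∣ₘ⁻ d))
    ... | inj₁ i∈ | inj₁ j∈ = ⊥-elim (indep i∈ j∈ ij)
    ... | inj₁ i∈ | inj₂ hj = meets (i , i∈ , inj₂ ij) hj
    ... | inj₂ hi | inj₁ j∈ = meets (j , j∈ , inj₂ (sym F ij)) hi
    ... | inj₂ hi | inj₂ hj = has-edge ij hi hj
    from′ : EdgeIdeal+ N[ L ] m → stage L m
    from′ (has-square i h) = _ , square i , var²∣ₘ⁺ (≤-trans h (m∣ₘp*ₘm P m i))
    from′ (has-edge ij hi hj) =
      _ , edge _ _ ij , var*var∣ₘ⁺ (Adj⇒≢ ij) (≤-trans hi (m∣ₘp*ₘm P m _)) (≤-trans hj (m∣ₘp*ₘm P m _))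
    from′ (meets (u , u∈ , inj₁ refl) h) = _ , square u , var²∣ₘ⁺ (+-mono-≤ (prodVars-∈ u∈) h)
    from′ (meets (u , u∈ , inj₂ ui) h) =
      _ , edge _ _ ui ,
      var*var∣ₘ⁺ (Adj⇒≢ ui) (≤-trans (prodVars-∈ u∈) (m≤m+n _ _)) (≤-trans h (m∣ₘp*ₘm P m _))

  stage-,ᵥ≐ : IndependentList L → (stage L ,ᵥ a) ≐ EdgeIdeal+ (N[ L ] ∪⁅ a ⁆)
  stage-,ᵥ≐ ind = ≐-trans (,ᵥ-resp-≐ (stage≐ ind)) EdgeIdeal+-,ᵥ

  DominationStep : List (Fin n) → Fin n → Set
  DominationStep L a = ∃[ b ] (¬ N[ L ] a × Adj F a b × IsolatedOutside (N[ L ] ∪⁅ a ⁆) b)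

  sphericalStep⇒dominationStep : (∀ u v → Dec (Adj F u v)) → IndependentList L →
                                 SphericalStep (stage L) a → DominationStep L a
  sphericalStep⇒dominationStep _ _ ((_ , inj₁ cone) , ¬cone) = ⊥-elim (¬cone cone)
  sphericalStep⇒dominationStep {L = L} {a = a} adj? ind ((a∉ , inj₂ (b , ¬cone-b , cone-b)) , _) =
    b , a∉ ∘ from (var∈⇔ (stage≐ ind)) , sym F ba , b-iso
    where
    b-iso : IsolatedOutside (N[ L ] ∪⁅ a ⁆) b
    b-iso = to (cone⇔isolated (stage-,ᵥ≐ ind)) cone-b
    ba : Adj F b a
    ba = decidable-stable (adj? b a) λ ¬ba → ¬cone-b (from (cone⇔isolated (stage≐ ind))
           (proj₁ b-iso ∘ inj₁ , λ x bx → [ id , (λ { refl → ⊥-elim (¬ba bx) }) ]′ (proj₂ b-iso x bx)))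

  sphericalChain⇒dominationChain : (∀ u v → Dec (Adj F u v)) → IndependentList pre →
    Chain (SphericalStep ∘ stage) pre rest → Chain DominationStep pre rest × IndependentList (pre ++ rest)
  sphericalChain⇒dominationChain {pre = pre} {rest = []} _ ind _ =
    tt , subst IndependentList (≡-sym (++-identityʳ pre)) ind
  sphericalChain⇒dominationChain {pre = pre} {rest = a ∷ rest} adj? ind (step , chain) =
    let dstep         = sphericalStep⇒dominationStep adj? ind step
        chain′ , ind′ =
          sphericalChain⇒dominationChain adj? (IndependentList-∷ʳ ind (proj₁ (proj₂ dstep))) chain
    in (dstep , chain′) , subst IndependentList (++-assoc pre [ a ] rest) ind′

  -- Paths and cycles

  data Path : Fin n → Fin n → List (Fin n) → Set where
    []ₚ  : Path x x []
    _∷ₚ_ : Adj F x y → Path y z vs → Path x z (y ∷ vs)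

  Path⇒Linked : Path x y vs → Adj F y z → Linked (Adj F) ((x ∷ vs) ∷ʳ z)
  Path⇒Linked []ₚ       yz = yz ∷ [-]
  Path⇒Linked (xy ∷ₚ p) yz = xy ∷ Path⇒Linked p yz

  closeCycle : Path x y vs → 2 ≤ length vs → Unique (x ∷ vs) → Adj F y x → HasCycle F
  closeCycle p long uniq yx = _ , _ , long , uniq , Path⇒Linked p yx

  Path-upTo : Path x y vs → z ∈ vs → ∃[ k ] Path x z (take (suc k) vs)
  Path-upTo (xz ∷ₚ _) (here refl) = 0 , xz ∷ₚ []ₚ
  Path-upTo (xw ∷ₚ p) (there z∈)  = let k , p′ = Path-upTo p z∈ in suc k , xw ∷ₚ p′

  chord⇒HasCycle : Path x y (w ∷ vs) → Unique (x ∷ w ∷ vs) → z ∈ vs → Adj F x z → HasCycle F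
  chord⇒HasCycle {vs = _ ∷ _} (xw ∷ₚ p) uniq z∈ xz =
    let k , p′ = Path-upTo p z∈ in closeCycle (xw ∷ₚ p′) (s≤s (s≤s z≤n)) (take⁺ (3 + k) uniq) (sym F xz)

  EdgeWithin : (Fin n → Set) → Fin n → Fin n → Set
  EdgeWithin W x y = Adj F x y × W x × W y

  SimplePathWithin : (Fin n → Set) → Fin n → Fin n → Set
  SimplePathWithin W x y = ∃[ vs ] (Path x y vs × Unique (x ∷ vs) × All W (x ∷ vs))

  shortcut : Path y z vs → Unique (y ∷ vs) → All W (y ∷ vs) → x ∈ y ∷ vs → SimplePathWithin W x z
  shortcut p        uniq       Ws       (here refl) = _ , p , uniq , Ws
  shortcut (_ ∷ₚ p) (_ ∷ uniq) (_ ∷ Ws) (there x∈)  = shortcut p uniq Ws x∈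

  walk⇒simplePath : W x → Star (EdgeWithin W) x y → SimplePathWithin W x y
  walk⇒simplePath Wx ε = [] , []ₚ , [] ∷ [] , Wx ∷ []
  walk⇒simplePath {x = x} Wx ((xz , _ , Wz) ◅ walk) with walk⇒simplePath Wz walk
  ... | vs , p , uniq , Ws with x ∈? (_ ∷ vs)
  ...   | yes x∈ = shortcut p uniq Ws x∈
  ...   | no x∉  = _ ∷ vs , xz ∷ₚ p , ¬Any⇒All¬ _ x∉ ∷ uniq , Wx ∷ Ws

  ∉-All : ¬ W a → All W vs → All (a ≢_) vs
  ∉-All {W = W} a∉ = All.map λ Wv a≡v → a∉ (subst W (≡-sym a≡v) Wv)

  forest-no-bypass : IsForest F → Adj F a b → ¬ W a → ¬ W b → Adj F b x → Adj F y a → W x →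
                     ¬ Star (EdgeWithin W) x y
  forest-no-bypass forest ab a∉ b∉ bx ya Wx walk =
    let _ , p , uniq , Ws = walk⇒simplePath Wx walk in
    forest (closeCycle (ab ∷ₚ (bx ∷ₚ p)) (s≤s (s≤s z≤n)) ((Adj⇒≢ ab ∷ ∉-All a∉ Ws) ∷ ∉-All b∉ Ws ∷ uniq) ya)

  AtMostOneNeighbourIn : (Fin n → Set) → Fin n → Set
  AtMostOneNeighbourIn H u =
    (∀ x → Adj F u x → ¬ H x) ⊎ ∃[ a ] (H a × Adj F u a × ∀ x → Adj F u x → H x → x ≡ a)

  -- The front of a maximal simple path inside H has at most its successor as a neighbour in H:
  -- any other one would close a cycle.
  forest-leaf : (∀ u v → Dec (Adj F u v)) → IsForest F → {H : Fin n → Set} → (∀ x → Dec (H x)) →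
                H v → ∃[ u ] (H u × AtMostOneNeighbourIn H u)
  forest-leaf adj? forest {H} H? Hv = grow n []ₚ ([] ∷ []) (Hv ∷ []) ≤-refl
    where
    front : Path u w vs → Unique (u ∷ vs) → All H (u ∷ vs) →
            (∀ x → Adj F u x → H x → x ∈ u ∷ vs) → AtMostOneNeighbourIn H u
    front {u = u} []ₚ _ _ onPath = inj₁ λ x ux Hx → isolated (onPath x ux Hx) ux
      where
      isolated : x ∈ u ∷ [] → ¬ Adj F u x
      isolated (here refl) = irrefl F
    front {u = u} {vs = q ∷ _} (uq ∷ₚ p) uniq (_ ∷ Hq ∷ _) onPath
      with any? (λ x → adj? u x ×-dec H? x ×-dec ¬? (x ≟ q))
    ... | no onlyQ =
      inj₂ (q , Hq , uq , λ x ux Hx → decidable-stable (x ≟ q) λ x≢q → onlyQ (x , ux , Hx , x≢q))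
    ... | yes (x , ux , Hx , x≢q) with onPath x ux Hx
    ...   | here refl         = ⊥-elim (irrefl F ux)
    ...   | there (here refl) = ⊥-elim (x≢q refl)
    ...   | there (there x∈)  = ⊥-elim (forest (chord⇒HasCycle (uq ∷ₚ p) uniq x∈ ux))

    grow : ∀ fuel → Path u w vs → Unique (u ∷ vs) → All H (u ∷ vs) → n < length (u ∷ vs) + fuel →
           ∃[ u ] (H u × AtMostOneNeighbourIn H u)
    grow zero _ uniq _ bound = ⊥-elim (<⇒≱ (subst (n <_) (+-identityʳ _) bound) (Unique⇒length≤ uniq))
    grow {u = u} {vs = vs} (suc fuel) p uniq Hs bound
      with any? (λ x → adj? u x ×-dec H? x ×-dec ¬? (x ∈? (u ∷ vs)))
    ... | yes (x , ux , Hx , x∉) =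
      grow fuel (sym F ux ∷ₚ p) (¬Any⇒All¬ _ x∉ ∷ uniq) (Hx ∷ Hs)
           (subst (n <_) (+-suc (length (u ∷ vs)) fuel) bound)
    ... | no stuck = u , All.head Hs , front p uniq Hs λ x ux Hx →
                       decidable-stable (x ∈? (u ∷ vs)) λ x∉ → stuck (x , ux , Hx , x∉)

  -- Maximal resolutions dominate

  N? : (∀ u v → Dec (Adj F u v)) → ∀ L v → Dec (N[ L ] v)
  N? adj? L v = any? λ u → (u ∈? L) ×-dec ((u ≟ v) ⊎-dec adj? u v)

  maximal⇒dominating : (∀ u v → Dec (Adj F u v)) → IsForest F → {as : List (Fin n)} → IndependentList as →
                       IsMaximalResolution (edgeIdeal F) as → ∀ v → N[ as ] v
  maximal⇒dominating adj? forest {as} ind (res , maximal) v =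
    decidable-stable (N? adj? as v) λ v∉ → extend (forest-leaf adj? forest (¬? ∘ N? adj? as) v∉)
    where
    extendBy : ∀ a → ResolutionStep (stage as) a → ⊥
    extendBy a step = maximal a (AllWithPrefix-∷ʳ {P = ResolutionStep ∘ stage} res step)
    extend : ∃[ u ] (¬ N[ as ] u × AtMostOneNeighbourIn (¬_ ∘ N[ as ]) u) → ⊥
    extend (u , u∉ , inj₁ noNbr) =
      extendBy u (u∉ ∘ to (var∈⇔ (stage≐ ind)) , inj₁ (from (cone⇔isolated (stage≐ ind)) (u∉ , nbrs)))
      where
      nbrs : ∀ x → Adj F u x → N[ as ] x
      nbrs x ux = decidable-stable (N? adj? as x) (noNbr x ux)
    extend (u , u∉ , inj₂ (a , a∉ , ua , onlyA)) =
      extendBy a (a∉ ∘ to (var∈⇔ (stage≐ ind)) , inj₂ (u , ¬cone , cone))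
      where
      ¬cone : ¬ IsCone (stage as) u
      ¬cone c = a∉ (proj₂ (to (cone⇔isolated (stage≐ ind)) c) a ua)
      nbrs : ∀ x → Adj F u x → (N[ as ] ∪⁅ a ⁆) x
      nbrs x ux with N? adj? as x
      ... | yes Nx = inj₁ Nx
      ... | no x∉  = inj₂ (≡-sym (onlyA x ux x∉))
      cone : IsCone (stage as ,ᵥ a) u
      cone = from (cone⇔isolated (stage-,ᵥ≐ ind)) ([ u∉ , (λ { refl → irrefl F ua }) ]′ , nbrs)

  -- Domination steps against a dominating set

  EdgeWithin-sym : EdgeWithin W x y → EdgeWithin W y x
  EdgeWithin-sym (xy , Wx , Wy) = sym F xy , Wy , Wx

  walk-out⇒≡ : Star (EdgeWithin W) x y → ¬ W y → x ≡ y
  walk-out⇒≡ ε                     _  = refl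
  walk-out⇒≡ ((_ , _ , Wz) ◅ walk) y∉ with walk-out⇒≡ walk y∉
  ... | refl = ⊥-elim (y∉ Wz)

  Joined : List (Fin n) → Fin n → Fin n → Set
  Joined pre = Star (EdgeWithin N[ pre ])

  Joined-∷ʳ : Joined pre x y → Joined (pre ∷ʳ a) x y
  Joined-∷ʳ = Star.map λ { (uv , Nu , Nv) → uv , N-∷ʳ⁺ˡ Nu , N-∷ʳ⁺ˡ Nv }

  module _ (forest : IsForest F) {D : Subset n} (D-dom : IsDominating F D) where

    -- ∣ S ∣ bounds the number of steps still possible: each domination step either retires the
    -- label of a D-vertex whose closed neighbourhood becomes dominated, or merges the labels of a
    -- D-neighbour of b and a D-neighbour of a, which differ since F is a forest.
    Labelling : List (Fin n) → Subset n → (Fin n → Fin n) → Set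
    Labelling pre S ρ =
      (∀ {v w} → v ∈ₛ D → ClosedAdj v w → ¬ N[ pre ] w → ρ v ∈ₛ S) ×
      (∀ {u v} → u ∈ₛ D → v ∈ₛ D → ρ u ≡ ρ v → Joined pre u v)

    Shrinks : List (Fin n) → Fin n → Subset n → Set
    Shrinks pre a S = ∃₂ λ S′ ρ′ → Labelling (pre ∷ʳ a) S′ ρ′ × ∣ S′ ∣ < ∣ S ∣

    retire : {S : Subset n} {ρ : Fin n → Fin n} → Labelling pre S ρ → z ∈ₛ D → ¬ N[ pre ] z →
             (∀ {w} → ClosedAdj z w → N[ pre ∷ʳ a ] w) → Shrinks pre a S
    retire {pre = pre} {z = z} {a = a} {S = S} {ρ} (active , joined) zD z∉ covered =
      S - ρ z , ρ , (active′ , λ uD vD eq → Joined-∷ʳ (joined uD vD eq)) ,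
      x∈p⇒∣p-x∣<∣p∣ (active zD (inj₁ refl) z∉)
      where
      active′ : v ∈ₛ D → ClosedAdj v w → ¬ N[ pre ∷ʳ a ] w → ρ v ∈ₛ S - ρ z
      active′ vD vw w∉ = x∈p∧x≢y⇒x∈p-y (active vD vw (w∉ ∘ N-∷ʳ⁺ˡ)) λ ρv≡ρz →
        w∉ (covered (subst (λ t → ClosedAdj t _) (walk-out⇒≡ (joined vD zD ρv≡ρz) z∉) vw))

    merge : {S : Subset n} {ρ : Fin n → Fin n} → Labelling pre S ρ → ¬ N[ pre ] a → ¬ N[ pre ] b → Adj F a b →
            x ∈ₛ D → Adj F x b → N[ pre ] x → y ∈ₛ D → Adj F y a → Shrinks pre a S
    merge {pre = pre} {a = a} {x = x} {y = y} {S = S} {ρ} (active , joined) a∉ b∉ ab xD xb Nx yD ya =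
      S - ρ y , ρ′ , (active′ , joined′) , x∈p⇒∣p-x∣<∣p∣ ρy∈S
      where
      ρx∈S : ρ x ∈ₛ S
      ρx∈S = active xD (inj₂ xb) b∉
      ρy∈S : ρ y ∈ₛ S
      ρy∈S = active yD (inj₂ ya) a∉
      ρx≢ρy : ρ x ≢ ρ y
      ρx≢ρy = forest-no-bypass forest ab a∉ b∉ (sym F xb) ya Nx ∘ joined xD yD
      ρ′ : Fin n → Fin n
      ρ′ v with ρ v ≟ ρ y
      ... | yes _ = ρ x
      ... | no _  = ρ v
      active′ : v ∈ₛ D → ClosedAdj v w → ¬ N[ pre ∷ʳ a ] w → ρ′ v ∈ₛ S - ρ y
      active′ {v = v} vD vw w∉ with ρ v ≟ ρ y
      ... | yes _    = x∈p∧x≢y⇒x∈p-y ρx∈S ρx≢ρy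
      ... | no ρv≢ρy = x∈p∧x≢y⇒x∈p-y (active vD vw (w∉ ∘ N-∷ʳ⁺ˡ)) ρv≢ρy
      bridge : Joined pre u y → Joined pre x v → Joined (pre ∷ʳ a) u v
      bridge uy xv =
        Joined-∷ʳ uy ◅◅
        (ya , N-∷ʳ⁺ʳ (inj₂ (sym F ya)) , N-∷ʳ⁺ʳ (inj₁ refl)) ◅
        (ab , N-∷ʳ⁺ʳ (inj₁ refl) , N-∷ʳ⁺ʳ (inj₂ ab)) ◅
        (sym F xb , N-∷ʳ⁺ʳ (inj₂ ab) , N-∷ʳ⁺ˡ Nx) ◅
        Joined-∷ʳ xv
      joined′ : u ∈ₛ D → v ∈ₛ D → ρ′ u ≡ ρ′ v → Joined (pre ∷ʳ a) u v
      joined′ {u = u} {v = v} uD vD eq with ρ u ≟ ρ y | ρ v ≟ ρ y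
      ... | yes ρu≡ρy | yes ρv≡ρy = Joined-∷ʳ (joined uD vD (trans ρu≡ρy (≡-sym ρv≡ρy)))
      ... | yes ρu≡ρy | no _      = bridge (joined uD yD ρu≡ρy) (joined xD vD eq)
      ... | no _      | yes ρv≡ρy =
        Star.reverse EdgeWithin-sym (bridge (joined vD yD ρv≡ρy) (joined xD uD (≡-sym eq)))
      ... | no _      | no _      = Joined-∷ʳ (joined uD vD eq)

    labelling-step : {S : Subset n} {ρ : Fin n → Fin n} → Labelling pre S ρ → DominationStep pre a →
                     Shrinks pre a S
    labelling-step {pre = pre} {a = a} {S = S} lab (b , a∉ , ab , b∉ , b-nbrs) =
      byMembership (b ∈ₛ? D) (a ∈ₛ? D)
      where
      b-covered : ClosedAdj b w → N[ pre ∷ʳ a ] w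
      b-covered (inj₁ refl) = N-∷ʳ⁺ʳ (inj₂ ab)
      b-covered (inj₂ bw)   = [ N-∷ʳ⁺ˡ , N-∷ʳ⁺ʳ ∘ inj₁ ]′ (b-nbrs _ bw)
      byMembership : Dec (b ∈ₛ D) → Dec (a ∈ₛ D) → Shrinks pre a S
      byMembership (yes bD) _        = retire lab bD (b∉ ∘ inj₁) b-covered
      byMembership (no _)   (yes aD) = retire lab aD a∉ N-∷ʳ⁺ʳ
      byMembership (no b∉D) (no a∉D) with D-dom b | D-dom a
      ... | inj₁ bD            | _                  = ⊥-elim (b∉D bD)
      ... | inj₂ _             | inj₁ aD            = ⊥-elim (a∉D aD)
      ... | inj₂ (x , xD , xb) | inj₂ (y , yD , ya) = merge lab a∉ (b∉ ∘ inj₁) ab xD xb Nx yD ya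
        where
        Nx : N[ pre ] x
        Nx = [ id , (λ { refl → ⊥-elim (a∉D xD) }) ]′ (b-nbrs x (sym F xb))

    chain-length≤ : {S : Subset n} {ρ : Fin n → Fin n} → Chain DominationStep pre rest → Labelling pre S ρ →
                    length rest ≤ ∣ S ∣
    chain-length≤ {rest = []}    _              _   = z≤n
    chain-length≤ {rest = _ ∷ _} (step , chain) lab =
      let _ , _ , lab′ , shrinks = labelling-step lab step in ≤-trans (s≤s (chain-length≤ chain lab′)) shrinks

    dominationChain-length≤ : Chain DominationStep [] rest → length rest ≤ ∣ D ∣
    dominationChain-length≤ chain = chain-length≤ {ρ = id} chain ((λ vD _ _ → vD) , λ { _ _ refl → ε })

  spherical⇒independentDominatingList : (∀ u v → Dec (Adj F u v)) → IsForest F → IsSpherical (edgeIdeal F) →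
    ∃[ as ] (IndependentList as × (∀ v → N[ as ] v) × (∀ D → IsDominating F D → length as ≤ ∣ D ∣))
  spherical⇒independentDominatingList adj? forest (as , maximal , spherical)
    with chain , ind ← sphericalChain⇒dominationChain adj? ((λ _ → z≤n) , λ ())
                         (AllWithPrefix⇒Chain [] as λ i → proj₁ maximal i , spherical i) =
    as , ind , maximal⇒dominating adj? forest ind maximal ,
    λ D D-dom → dominationChain-length≤ forest D-dom chain

  domination≡independentDomination : (∀ u v → Dec (Adj F u v)) → IsForest F → IsSpherical (edgeIdeal F) →
    ∀ {γ i} → IsDominationNumber F γ → IsIndepDominationNumber F i → γ ≡ i
  domination≡independentDomination adj? forest spherical {γ} {i}
    ((D , D-dom , ∣D∣≡γ) , γ-min) ((S , S-dom , S-indep , ∣S∣≡i) , i-min)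
    with as , ind , dominating , short ← spherical⇒independentDominatingList adj? forest spherical =
    ≤-antisym (subst (γ ≤_) ∣S∣≡i (γ-min S S-dom)) (begin
      i           ≤⟨ i-min A A-dom A-indep ⟩
      ∣ A ∣       ≤⟨ ∣fromList∣≤length as ⟩
      length as   ≤⟨ short D D-dom ⟩
      ∣ D ∣       ≡⟨ ∣D∣≡γ ⟩
      γ           ∎)
    where
    open ≤-Reasoning
    A : Subset n
    A = fromList as
    A-dom : IsDominating F A
    A-dom v with u , u∈ , uv ← dominating v =
      Sum.map (λ u≡v → subst (_∈ₛ A) u≡v (∈-fromList⁺ u∈)) (λ uv → u , ∈-fromList⁺ u∈ , uv) uv
    A-indep : IsIndependent F A
    A-indep u v u∈ v∈ = proj₂ ind (∈-fromList⁻ as u∈) (∈-fromList⁻ as v∈)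

-- Adjacency need not be decidable, but γ ≡ i is, so decidability of adjacency may be assumed.
corollary6p5 : ∀ (n : ℕ) (F : SimpleGraph n) → IsForest F →
    IsSpherical (edgeIdeal F) →
    ∀ (γ i : ℕ) → IsDominationNumber F γ → IsIndepDominationNumber F i → γ ≡ i
corollary6p5 n F forest spherical γ i γ-number i-number =
  decidable-stable (γ ℕ.≟ i) λ γ≢i →
    ¬¬-∀-Fin (λ u → ¬¬-∀-Fin λ v → ¬¬-excluded-middle) λ adj? →
      γ≢i (domination≡independentDomination F adj? forest spherical γ-number i-number)
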